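{- Let $r,s$ be positive integers and $n$ a positive integer. (i) The number of Dyck paths of semilength $n$ with first ascent $\ge r$, at least one interior return, and last descent $\ge s$ is $C^{(r+s+1)}_{n-r-s}$. (ii) The number of Dyck paths of semilength $n$ with first ascent $\ge r$ and last descent $\ge s$ is $\sum_{j=0}^{\min(r,s)}C^{(r+s+1-2j)}_{n-r-s+j}$.
   Context: A Dyck path of semilength $n$ is a sequence of $n$ upsteps $(1,1)$ and $n$ downsteps $(1,-1)$ starting at the origin and never going below the $x$-axis. Its first ascent is the length of its initial maximal run of upsteps and its last descent is the length of its final maximal run of downsteps. An interior return is a point of the path on the $x$-axis other than its initial and terminal points. For integers $k\ge0$ and $m$, $C^{(k)}_m=[x^m]C(x)^k$ with $C(x)$ the Catalan generating function; so $C^{(k)}_m=\frac{k}{2m+k}\binom{2m+k}{m}$ for $m\ge0,k\ge1$, and $C^{(k)}_m=0$ for $m<0$. -}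

module Defs where

open import Data.Bool using (Bool; true; false; _∧_; not)
open import Data.Nat using (ℕ; zero; suc; _+_; _*_; _∸_; _≡ᵇ_; _≤ᵇ_)
open import Data.Nat.DivMod using (_/_)
open import Data.Nat.Combinatorics using (_C_)
open import Data.Integer using (ℤ; +_; -[1+_])
open import Data.List using (List; []; _∷_; _++_; map; length; reverse; take; filterᵇ; applyUpTo; upTo)
open import Data.Bool.ListAction using (any)
open import Data.Nat.ListAction using (sum)

-- Steps of a lattice path: U = upstep (1,1), D = downstep (1,-1).
data Step : Set where
  U D : Step

isU : Step → Bool
isU U = true
isU D = false

isD : Step → Bool
isD s = not (isU s)

allWords : ℕ → List (List Step)
allWords zero = [] ∷ []
allWords (suc k) = map (U ∷_) (allWords k) ++ map (D ∷_) (allWords k)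

dyckFrom : ℕ → List Step → Bool
dyckFrom h [] = h ≡ᵇ 0
dyckFrom h (U ∷ w) = dyckFrom (suc h) w
dyckFrom zero (D ∷ w) = false
dyckFrom (suc h) (D ∷ w) = dyckFrom h w

isDyckOfSemilength : ℕ → List Step → Bool
isDyckOfSemilength n w = (length w ≡ᵇ 2 * n) ∧ dyckFrom 0 w

leadRun : (Step → Bool) → List Step → ℕ
leadRun p [] = 0
leadRun p (x ∷ w) with p x
... | true = suc (leadRun p w)
... | false = 0

firstAscent : List Step → ℕ
firstAscent = leadRun isU

lastDescent : List Step → ℕ
lastDescent w = leadRun isD (reverse w)

countᵇ : (Step → Bool) → List Step → ℕ
countᵇ p w = length (filterᵇ p w)

onAxisAfter : List Step → ℕ → Bool
onAxisAfter w i = countᵇ isU (take i w) ≡ᵇ countᵇ isD (take i w)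

hasInteriorReturn : List Step → Bool
hasInteriorReturn w = any (onAxisAfter w) (applyUpTo suc (length w ∸ 1))

catalan : ℕ → ℕ
catalan m = ((2 * m) C m) / suc m

-- CPow k m = [x^m] C(x)^k, via C(x)^0 = 1, C(x)^(k+1) = C(x) * C(x)^k
CPow : ℕ → ℕ → ℕ
CPow zero zero = 1
CPow zero (suc m) = 0
CPow (suc k) m = sum (map (λ i → catalan i * CPow k (m ∸ i)) (upTo (suc m)))

Cgen : ℕ → ℤ → ℕ
Cgen k (+ m) = CPow k m
Cgen k -[1+ m ] = 0

countDyck : ℕ → (List Step → Bool) → ℕ
countDyck n p = length (filterᵇ (λ w → isDyckOfSemilength n w ∧ p w) (allWords (2 * n)))

-- A Dyck path with first ascent ≥ r and last descent ≥ s is U^r x D^s, where x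
-- has length 2n − r − s and x D^s is a nonnegative walk from height r to the
-- axis. Such walks that touch the axis before their last step are as many as
-- the nonnegative walks from height r + s to the axis, which gives (i); the
-- others are, shifted down by one, the same objects for r − 1 and s − 1, and
-- iterating gives the sum in (ii). Finally, C^(k)_m is the number E(k, m) of
-- nonnegative walks of length k − 1 + 2m from height k − 1 to the axis: splitting
-- off the first step gives E(k+1, m+1) = E(k, m+1) + E(k+2, m), which forces
-- E(a + b, ·) to be the convolution of E(a, ·) and E(b, ·), and for k = 1 the
-- ballot formula (reflection principle) yields the Catalan numbers.

module Submission where

open import Defs
open import Data.Bool using (Bool; true; false; _∧_; _∨_; if_then_else_; T?)
open import Data.Bool.Properties using (∧-identityʳ; ∧-zeroʳ; T-≡)
open import Data.Bool.ListAction using (any)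
open import Function using (_∘_; id)
open import Function.Bundles using (Equivalence)
open import Data.Nat
open import Data.Nat.Properties
open import Data.Nat.Combinatorics using (_C_; nC1≡n; nCk≡nC[n∸k]; k>n⇒nCk≡0; nCk+nC[k+1]≡[n+1]C[k+1])
open import Data.Nat.DivMod using (_/_; m*n/n≡m)
open import Data.Nat.Tactic.RingSolver using (solve-∀; solve)
open import Data.List using (List; []; _∷_; _++_; _∷ʳ_; map; length; reverse; replicate; take; filterᵇ; applyUpTo; upTo)
open import Data.List.Properties using (filter-++; length-++; ++-assoc; ++-identityʳ; reverse-++; unfold-reverse; length-reverse)
open import Data.Nat.ListAction using (sum)
open import Relation.Binary.PropositionalEquality
open import Relation.Nullary using (yes; no)
open import Data.Product using (_×_; _,_)
open import Data.Empty using (⊥-elim)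
open import Algebra.Properties.CommutativeSemigroup +-commutativeSemigroup using (interchange)

countWords : ℕ → (List Step → Bool) → ℕ
countWords zero p = if p [] then 1 else 0
countWords (suc k) p = countWords k (λ w → p (U ∷ w)) + countWords k (λ w → p (D ∷ w))

countWords-cong : ∀ k {p q : List Step → Bool} →
  (∀ w → length w ≡ k → p w ≡ q w) → countWords k p ≡ countWords k q
countWords-cong zero {p} {q} p≗q rewrite p≗q [] refl = refl
countWords-cong (suc k) p≗q = cong₂ _+_
  (countWords-cong k (λ w ∣w∣≡k → p≗q (U ∷ w) (cong suc ∣w∣≡k)))
  (countWords-cong k (λ w ∣w∣≡k → p≗q (D ∷ w) (cong suc ∣w∣≡k)))

countWords-false : ∀ k → countWords k (λ _ → false) ≡ 0
countWords-false zero = refl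
countWords-false (suc k) = cong₂ _+_ (countWords-false k) (countWords-false k)

countWords-∷ʳ : ∀ k p → countWords (suc k) p ≡
  countWords k (λ w → p (w ∷ʳ U)) + countWords k (λ w → p (w ∷ʳ D))
countWords-∷ʳ zero p = refl
countWords-∷ʳ (suc k) p = begin
  countWords (suc k) (λ w → p (U ∷ w)) + countWords (suc k) (λ w → p (D ∷ w))
    ≡⟨ cong₂ _+_ (countWords-∷ʳ k (λ w → p (U ∷ w))) (countWords-∷ʳ k (λ w → p (D ∷ w))) ⟩
  (#UU + #UD) + (#DU + #DD)  ≡⟨ interchange #UU #UD #DU #DD ⟩
  (#UU + #DU) + (#UD + #DD)  ∎
  where
  open ≡-Reasoning
  #UU = countWords k (λ w → p (U ∷ w ∷ʳ U))
  #UD = countWords k (λ w → p (U ∷ w ∷ʳ D))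
  #DU = countWords k (λ w → p (D ∷ w ∷ʳ U))
  #DD = countWords k (λ w → p (D ∷ w ∷ʳ D))

length-filterᵇ-map : ∀ (p : List Step → Bool) (f : List Step → List Step) xs →
  length (filterᵇ p (map f xs)) ≡ length (filterᵇ (λ w → p (f w)) xs)
length-filterᵇ-map p f [] = refl
length-filterᵇ-map p f (x ∷ xs) with p (f x)
... | true = cong suc (length-filterᵇ-map p f xs)
... | false = length-filterᵇ-map p f xs

length-filterᵇ-allWords : ∀ k p → length (filterᵇ p (allWords k)) ≡ countWords k p
length-filterᵇ-allWords zero p with p []
... | true = refl
... | false = refl
length-filterᵇ-allWords (suc k) p = begin
  length (filterᵇ p (Uws ++ Dws))
    ≡⟨ cong length (filter-++ (T? ∘ p) Uws Dws) ⟩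
  length (filterᵇ p Uws ++ filterᵇ p Dws)
    ≡⟨ length-++ (filterᵇ p Uws) ⟩
  length (filterᵇ p Uws) + length (filterᵇ p Dws)
    ≡⟨ cong₂ _+_ (length-filterᵇ-map p (U ∷_) (allWords k)) (length-filterᵇ-map p (D ∷_) (allWords k)) ⟩
  length (filterᵇ (λ w → p (U ∷ w)) (allWords k)) + length (filterᵇ (λ w → p (D ∷ w)) (allWords k))
    ≡⟨ cong₂ _+_ (length-filterᵇ-allWords k (λ w → p (U ∷ w))) (length-filterᵇ-allWords k (λ w → p (D ∷ w))) ⟩
  countWords (suc k) p ∎
  where
  open ≡-Reasoning
  Uws = map (U ∷_) (allWords k)
  Dws = map (D ∷_) (allWords k)

dyckWalks : ℕ → ℕ → ℕ
dyckWalks h L = countWords L (dyckFrom h)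

L<h⇒dyckWalks≡0 : ∀ {h L} → L < h → dyckWalks h L ≡ 0
L<h⇒dyckWalks≡0 {suc h} {zero} _ = refl
L<h⇒dyckWalks≡0 {suc zero} {suc L} (s≤s ())
L<h⇒dyckWalks≡0 {suc (suc h)} {suc L} (s≤s L<1+h) =
  cong₂ _+_ (L<h⇒dyckWalks≡0 (m<n⇒m<1+n (m<n⇒m<1+n L<1+h))) (L<h⇒dyckWalks≡0 L<1+h)

dyckWalks-diagonal : ∀ h → dyckWalks h h ≡ 1
dyckWalks-diagonal zero = refl
dyckWalks-diagonal (suc h) =
  trans (cong (_+ dyckWalks h h) (L<h⇒dyckWalks≡0 (m<n⇒m<1+n (n<1+n h)))) (dyckWalks-diagonal h)

CPowWalks : ℕ → ℕ → ℕ
CPowWalks zero zero = 1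
CPowWalks zero (suc m) = 0
CPowWalks (suc k) m = dyckWalks k (k + 2 * m)

CPowWalks-zero : ∀ k → CPowWalks k 0 ≡ 1
CPowWalks-zero zero = refl
CPowWalks-zero (suc k) = trans (cong (dyckWalks k) (+-identityʳ k)) (dyckWalks-diagonal k)

CPowWalks-suc-suc : ∀ k m →
  CPowWalks (suc k) (suc m) ≡ CPowWalks k (suc m) + CPowWalks (suc (suc k)) m
CPowWalks-suc-suc zero m = begin
  dyckWalks 0 (2 * suc m)
    ≡⟨ cong (dyckWalks 0) (*-suc 2 m) ⟩
  dyckWalks 1 (1 + 2 * m) + countWords (1 + 2 * m) (λ _ → false)
    ≡⟨ cong (dyckWalks 1 (1 + 2 * m) +_) (countWords-false (1 + 2 * m)) ⟩
  dyckWalks 1 (1 + 2 * m) + 0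
    ≡⟨ +-identityʳ _ ⟩
  dyckWalks 1 (1 + 2 * m) ∎
  where open ≡-Reasoning
CPowWalks-suc-suc (suc k) m =
  trans (+-comm (dyckWalks (2 + k) L) (dyckWalks k L)) (cong (dyckWalks k L +_) (cong (dyckWalks (2 + k)) L≡))
  where
  L = k + 2 * suc m
  L≡ : k + 2 * suc m ≡ 2 + k + 2 * m
  L≡ = solve (k ∷ m ∷ [])

Σ< : ℕ → (ℕ → ℕ) → ℕ
Σ< zero f = 0
Σ< (suc k) f = f 0 + Σ< k (f ∘ suc)

syntax Σ< k (λ i → e) = Σ[ i < k ] e

Σ<-cong : ∀ k {f g : ℕ → ℕ} → (∀ i → i < k → f i ≡ g i) → Σ< k f ≡ Σ< k g
Σ<-cong zero f≗g = refl
Σ<-cong (suc k) f≗g = cong₂ _+_ (f≗g 0 z<s) (Σ<-cong k (λ i i<k → f≗g (suc i) (s<s i<k)))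

Σ<-zero : ∀ k {f : ℕ → ℕ} → (∀ i → i < k → f i ≡ 0) → Σ< k f ≡ 0
Σ<-zero zero f≗0 = refl
Σ<-zero (suc k) f≗0 = cong₂ _+_ (f≗0 0 z<s) (Σ<-zero k (λ i i<k → f≗0 (suc i) (s<s i<k)))

Σ<-+ : ∀ k (f g : ℕ → ℕ) → Σ[ i < k ] (f i + g i) ≡ Σ< k f + Σ< k g
Σ<-+ zero f g = refl
Σ<-+ (suc k) f g = trans (cong (f 0 + g 0 +_) (Σ<-+ k (f ∘ suc) (g ∘ suc)))
  (interchange (f 0) (g 0) (Σ< k (f ∘ suc)) (Σ< k (g ∘ suc)))

sum-map-applyUpTo : ∀ k (f g : ℕ → ℕ) → sum (map g (applyUpTo f k)) ≡ Σ[ i < k ] g (f i)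
sum-map-applyUpTo zero f g = refl
sum-map-applyUpTo (suc k) f g = cong (g (f 0) +_) (sum-map-applyUpTo k (f ∘ suc) g)

CPowWalks-convolution : ∀ m a b → Σ[ i < suc m ] (CPowWalks a i * CPowWalks b (m ∸ i)) ≡ CPowWalks (a + b) m
CPowWalks-convolution m zero b = trans (cong₂ _+_ (+-identityʳ (CPowWalks b m)) (Σ<-zero m (λ _ _ → refl))) (+-identityʳ _)
CPowWalks-convolution m (suc a) b = begin
  E (suc a) 0 * E b m + Σ[ i < m ] (E (suc a) (suc i) * E b (m ∸ suc i))
    ≡⟨ cong₂ _+_ (cong (_* E b m) (trans (CPowWalks-zero (suc a)) (sym (CPowWalks-zero a))))
                 (trans (Σ<-cong m (λ i _ → split i)) (Σ<-+ m _ _)) ⟩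
  E a 0 * E b m + (Σ[ i < m ] (E a (suc i) * E b (m ∸ suc i)) + Σ[ i < m ] (E (2 + a) i * E b (m ∸ suc i)))
    ≡⟨ +-assoc (E a 0 * E b m) _ _ ⟨
  Σ[ i < suc m ] (E a i * E b (m ∸ i)) + Σ[ i < m ] (E (2 + a) i * E b (m ∸ suc i))
    ≡⟨ cong (_+ Σ[ i < m ] (E (2 + a) i * E b (m ∸ suc i))) (CPowWalks-convolution m a b) ⟩
  E (a + b) m + Σ[ i < m ] (E (2 + a) i * E b (m ∸ suc i))
    ≡⟨ shifted m ⟩
  E (suc a + b) m ∎
  where
  open ≡-Reasoning
  E = CPowWalks
  split : ∀ i → E (suc a) (suc i) * E b (m ∸ suc i) ≡ E a (suc i) * E b (m ∸ suc i) + E (2 + a) i * E b (m ∸ suc i)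
  split i = trans (cong (_* E b (m ∸ suc i)) (CPowWalks-suc-suc a i)) (*-distribʳ-+ (E b (m ∸ suc i)) (E a (suc i)) _)
  shifted : ∀ m → E (a + b) m + Σ[ i < m ] (E (2 + a) i * E b (m ∸ suc i)) ≡ E (suc a + b) m
  shifted zero = trans (+-identityʳ _) (trans (CPowWalks-zero (a + b)) (sym (CPowWalks-zero (suc (a + b)))))
  shifted (suc m) = trans (cong (E (a + b) (suc m) +_) (CPowWalks-convolution m (2 + a) b)) (sym (CPowWalks-suc-suc (a + b) m))

[m+n]Cm≡[m+n]Cn : ∀ m n → (m + n) C m ≡ (m + n) C n
[m+n]Cm≡[m+n]Cn m n = trans (nCk≡nC[n∸k] (m≤m+n m n)) (cong ((m + n) C_) (m+n∸m≡n m n))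

[k+1]*[n+1]C[k+1]≡[n+1]*nCk : ∀ n k → suc k * (suc n C suc k) ≡ suc n * (n C k)
[k+1]*[n+1]C[k+1]≡[n+1]*nCk zero zero = refl
[k+1]*[n+1]C[k+1]≡[n+1]*nCk zero (suc k)
  rewrite k>n⇒nCk≡0 {1} {suc (suc k)} (s<s z<s) | k>n⇒nCk≡0 {0} {suc k} z<s = *-zeroʳ (suc (suc k))
[k+1]*[n+1]C[k+1]≡[n+1]*nCk (suc n) zero = trans (+-identityʳ _) (trans (nC1≡n (suc (suc n))) (sym (*-identityʳ _)))
[k+1]*[n+1]C[k+1]≡[n+1]*nCk (suc n) (suc k) = begin
  (2 + k) * ((2 + n) C (2 + k))      ≡⟨ cong ((2 + k) *_) (nCk+nC[k+1]≡[n+1]C[k+1] (suc n) (suc k)) ⟨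
  (2 + k) * (X + Y)                  ≡⟨ regroup k X Y ⟩
  X + ((1 + k) * X + (2 + k) * Y)    ≡⟨ cong₂ (λ u v → X + (u + v)) (absorb n k) (absorb n (suc k)) ⟩
  X + ((1 + n) * A + (1 + n) * B)    ≡⟨ cong (X +_) (*-distribˡ-+ (1 + n) A B) ⟨
  X + (1 + n) * (A + B)              ≡⟨ cong (λ u → X + (1 + n) * u) (nCk+nC[k+1]≡[n+1]C[k+1] n k) ⟩
  (2 + n) * X                        ∎
  where
  open ≡-Reasoning
  X = suc n C suc k
  Y = suc n C suc (suc k)
  A = n C k
  B = n C suc k
  absorb = [k+1]*[n+1]C[k+1]≡[n+1]*nCk
  regroup : ∀ k X Y → (2 + k) * (X + Y) ≡ X + ((1 + k) * X + (2 + k) * Y)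
  regroup = solve-∀

[k+1]*[n+k+1]C[k+1]≡[n+1]*[n+k+1]Ck : ∀ n k → suc k * (suc (n + k) C suc k) ≡ suc n * (suc (n + k) C k)
[k+1]*[n+k+1]C[k+1]≡[n+1]*[n+k+1]Ck n k = begin
  suc k * (suc (n + k) C suc k)  ≡⟨ [k+1]*[n+1]C[k+1]≡[n+1]*nCk (n + k) k ⟩
  suc (n + k) * ((n + k) C k)    ≡⟨ cong (suc (n + k) *_) ([m+n]Cm≡[m+n]Cn n k) ⟨
  suc (n + k) * ((n + k) C n)    ≡⟨ [k+1]*[n+1]C[k+1]≡[n+1]*nCk (n + k) n ⟨
  suc n * (suc (n + k) C suc n)  ≡⟨ cong (suc n *_) ([m+n]Cm≡[m+n]Cn (suc n) k) ⟩
  suc n * (suc (n + k) C k)      ∎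
  where open ≡-Reasoning

CPowWalks-one : ∀ h → CPowWalks (suc h) 1 ≡ suc h
CPowWalks-one zero = refl
CPowWalks-one (suc h) = begin
  CPowWalks (2 + h) 1                        ≡⟨ CPowWalks-suc-suc (suc h) 0 ⟩
  CPowWalks (suc h) 1 + CPowWalks (3 + h) 0  ≡⟨ cong₂ _+_ (CPowWalks-one h) (CPowWalks-zero (3 + h)) ⟩
  suc h + 1                                  ≡⟨ +-comm (suc h) 1 ⟩
  2 + h                                      ∎
  where open ≡-Reasoning

-- Reflection principle: of the N C (u+1) unrestricted walks of length
-- N = h + 2(u+1) from height h to the axis, N C u go below the axis.
CPowWalks-ballot : ∀ h u → CPowWalks (suc h) (suc u) + (h + 2 * suc u) C u ≡ (h + 2 * suc u) C suc u
CPowWalks-ballot h zero = begin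
  CPowWalks (suc h) 1 + 1  ≡⟨ cong (_+ 1) (CPowWalks-one h) ⟩
  suc h + 1                ≡⟨ +-suc h 1 ⟨
  h + 2                    ≡⟨ nC1≡n (h + 2) ⟨
  (h + 2) C 1              ∎
  where open ≡-Reasoning
CPowWalks-ballot zero (suc u) = begin
  E 1 (2 + u) + N C suc u            ≡⟨ cong₂ _+_ (CPowWalks-suc-suc 0 (suc u)) (cong (_C suc u) N≡1+K) ⟩
  E 2 (suc u) + suc K C suc u        ≡⟨ cong (E 2 (suc u) +_) (nCk+nC[k+1]≡[n+1]C[k+1] K u) ⟨
  E 2 (suc u) + (K C u + K C suc u)  ≡⟨ +-assoc (E 2 (suc u)) (K C u) (K C suc u) ⟨
  E 2 (suc u) + K C u + K C suc u    ≡⟨ cong (_+ K C suc u) (CPowWalks-ballot 1 u) ⟩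
  K C suc u + K C suc u              ≡⟨ cong (K C suc u +_) K-symmetry ⟩
  K C suc u + K C (2 + u)            ≡⟨ nCk+nC[k+1]≡[n+1]C[k+1] K (suc u) ⟩
  suc K C (2 + u)                    ≡⟨ cong (_C (2 + u)) N≡1+K ⟨
  N C (2 + u)                        ∎
  where
  open ≡-Reasoning
  E = CPowWalks
  K = 1 + 2 * suc u
  N = 2 * suc (suc u)
  N≡1+K : 2 * suc (suc u) ≡ suc (1 + 2 * suc u)
  N≡1+K = solve (u ∷ [])
  K≡ : suc u + suc (suc u) ≡ 1 + 2 * suc u
  K≡ = solve (u ∷ [])
  K-symmetry : K C suc u ≡ K C (2 + u)
  K-symmetry = subst (λ L → L C suc u ≡ L C (2 + u)) K≡ ([m+n]Cm≡[m+n]Cn (suc u) (2 + u))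
CPowWalks-ballot (suc h) (suc u) = begin
  E (2 + h) (2 + u) + suc N C suc u
    ≡⟨ cong₂ _+_ (CPowWalks-suc-suc (suc h) (suc u)) (sym (nCk+nC[k+1]≡[n+1]C[k+1] N u)) ⟩
  (E (suc h) (2 + u) + E3) + (N C u + N C suc u)
    ≡⟨ regroup (E (suc h) (2 + u)) E3 (N C u) (N C suc u) ⟩
  (E (suc h) (2 + u) + N C suc u) + (E3 + N C u)
    ≡⟨ cong₂ _+_ (CPowWalks-ballot h (suc u)) ballot-shifted ⟩
  N C (2 + u) + N C suc u
    ≡⟨ +-comm (N C (2 + u)) (N C suc u) ⟩
  N C suc u + N C (2 + u)
    ≡⟨ nCk+nC[k+1]≡[n+1]C[k+1] N (suc u) ⟩
  suc N C (2 + u) ∎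
  where
  open ≡-Reasoning
  E = CPowWalks
  N = h + 2 * suc (suc u)
  E3 = E (3 + h) (suc u)
  N≡ : h + 2 * suc (suc u) ≡ 2 + h + 2 * suc u
  N≡ = solve (h ∷ u ∷ [])
  ballot-shifted : E3 + N C u ≡ N C suc u
  ballot-shifted = subst (λ L → E3 + L C u ≡ L C suc u) (sym N≡) (CPowWalks-ballot (2 + h) u)
  regroup : ∀ a b c d → (a + b) + (c + d) ≡ (a + d) + (b + c)
  regroup = solve-∀

catalan≡CPowWalks-one : ∀ m → catalan m ≡ CPowWalks 1 m
catalan≡CPowWalks-one zero = refl
catalan≡CPowWalks-one (suc m) = trans (cong (_/ suc (suc m)) X≡E*[m+2]) (m*n/n≡m E (suc (suc m)))
  where
  open ≡-Reasoning
  N = 2 * suc m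
  X = N C suc m
  Y = N C m
  E = CPowWalks 1 (suc m)
  E+Y≡X : E + Y ≡ X
  E+Y≡X = CPowWalks-ballot 0 m
  N≡ : suc (suc m + m) ≡ 2 * suc m
  N≡ = solve (m ∷ [])
  ratio : suc m * X ≡ suc (suc m) * Y
  ratio = subst (λ L → suc m * (L C suc m) ≡ suc (suc m) * (L C m)) N≡ ([k+1]*[n+k+1]C[k+1]≡[n+1]*[n+k+1]Ck (suc m) m)
  Y≡[m+1]*E : Y ≡ suc m * E
  Y≡[m+1]*E = +-cancelˡ-≡ (suc m * Y) Y (suc m * E) (begin
    suc m * Y + Y        ≡⟨ +-comm (suc m * Y) Y ⟩
    suc (suc m) * Y      ≡⟨ ratio ⟨
    suc m * X            ≡⟨ cong (suc m *_) E+Y≡X ⟨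
    suc m * (E + Y)      ≡⟨ *-distribˡ-+ (suc m) E Y ⟩
    suc m * E + suc m * Y ≡⟨ +-comm (suc m * E) (suc m * Y) ⟩
    suc m * Y + suc m * E ∎)
  X≡E*[m+2] : X ≡ E * suc (suc m)
  X≡E*[m+2] = begin
    X                ≡⟨ E+Y≡X ⟨
    E + Y            ≡⟨ cong (E +_) Y≡[m+1]*E ⟩
    suc (suc m) * E  ≡⟨ *-comm (suc (suc m)) E ⟩
    E * suc (suc m)  ∎

CPow≡CPowWalks : ∀ k m → CPow k m ≡ CPowWalks k m
CPow≡CPowWalks zero zero = refl
CPow≡CPowWalks zero (suc m) = refl
CPow≡CPowWalks (suc k) m = begin
  sum (map (λ i → catalan i * CPow k (m ∸ i)) (upTo (suc m)))
    ≡⟨ sum-map-applyUpTo (suc m) id (λ i → catalan i * CPow k (m ∸ i)) ⟩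
  Σ[ i < suc m ] (catalan i * CPow k (m ∸ i))
    ≡⟨ Σ<-cong (suc m) (λ i _ → cong₂ _*_ (catalan≡CPowWalks-one i) (CPow≡CPowWalks k (m ∸ i))) ⟩
  Σ[ i < suc m ] (CPowWalks 1 i * CPowWalks k (m ∸ i))
    ≡⟨ CPowWalks-convolution m 1 k ⟩
  CPowWalks (suc k) m ∎
  where open ≡-Reasoning

replicate-∷ʳ : ∀ {A : Set} n (x : A) → replicate n x ∷ʳ x ≡ x ∷ replicate n x
replicate-∷ʳ zero x = refl
replicate-∷ʳ (suc n) x = cong (x ∷_) (replicate-∷ʳ n x)

[1+m]≤ᵇ[1+n]≡m≤ᵇn : ∀ m n → (suc m ≤ᵇ suc n) ≡ (m ≤ᵇ n)
[1+m]≤ᵇ[1+n]≡m≤ᵇn zero n = refl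
[1+m]≤ᵇ[1+n]≡m≤ᵇn (suc m) n = refl

leadRun≤length : ∀ p w → leadRun p w ≤ length w
leadRun≤length p [] = z≤n
leadRun≤length p (x ∷ w) with p x
... | true = s≤s (leadRun≤length p w)
... | false = z≤n

leadRun-∷ʳ-reject : ∀ p ys {x} → p x ≡ false → leadRun p (ys ∷ʳ x) ≡ leadRun p ys
leadRun-∷ʳ-reject p [] px rewrite px = refl
leadRun-∷ʳ-reject p (y ∷ ys) px with p y
... | true = cong suc (leadRun-∷ʳ-reject p ys px)
... | false = refl

lastDescent-∷ʳ : ∀ w x → lastDescent (w ∷ʳ x) ≡ leadRun isD (x ∷ reverse w)
lastDescent-∷ʳ w x = cong (leadRun isD) (reverse-++ w (x ∷ []))

lastDescent-U∷ : ∀ w → lastDescent (U ∷ w) ≡ lastDescent w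
lastDescent-U∷ w = trans (cong (leadRun isD) (unfold-reverse U w)) (leadRun-∷ʳ-reject isD (reverse w) refl)

lastDescent-replicateU-++ : ∀ r w → lastDescent (replicate r U ++ w) ≡ lastDescent w
lastDescent-replicateU-++ zero w = refl
lastDescent-replicateU-++ (suc r) w = trans (lastDescent-U∷ (replicate r U ++ w)) (lastDescent-replicateU-++ r w)

lastDescent≤length : ∀ w → lastDescent w ≤ length w
lastDescent≤length w = subst (lastDescent w ≤_) (length-reverse w) (leadRun≤length isD (reverse w))

firstAscent+lastDescent≤length : ∀ w → firstAscent w + lastDescent w ≤ length w
firstAscent+lastDescent≤length [] = z≤n
firstAscent+lastDescent≤length (U ∷ w) rewrite lastDescent-U∷ w = s≤s (firstAscent+lastDescent≤length w)
firstAscent+lastDescent≤length (D ∷ w) = lastDescent≤length (D ∷ w)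

countWords-firstAscent : ∀ r L q →
  countWords (r + L) (λ w → (r ≤ᵇ firstAscent w) ∧ q w) ≡ countWords L (λ v → q (replicate r U ++ v))
countWords-firstAscent zero L q = refl
countWords-firstAscent (suc r) L q = begin
  countWords (r + L) (λ w → (suc r ≤ᵇ suc (firstAscent w)) ∧ q (U ∷ w)) + countWords (r + L) (λ _ → false)
    ≡⟨ cong₂ _+_ (countWords-cong (r + L) (λ w _ → cong (_∧ q (U ∷ w)) ([1+m]≤ᵇ[1+n]≡m≤ᵇn r (firstAscent w))))
                 (countWords-false (r + L)) ⟩
  countWords (r + L) (λ w → (r ≤ᵇ firstAscent w) ∧ q (U ∷ w)) + 0
    ≡⟨ +-identityʳ _ ⟩
  countWords (r + L) (λ w → (r ≤ᵇ firstAscent w) ∧ q (U ∷ w))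
    ≡⟨ countWords-firstAscent r L (λ w → q (U ∷ w)) ⟩
  countWords L (λ v → q (replicate (suc r) U ++ v)) ∎
  where open ≡-Reasoning

countWords-lastDescent : ∀ s L q →
  countWords (s + L) (λ w → (s ≤ᵇ lastDescent w) ∧ q w) ≡ countWords L (λ x → q (x ++ replicate s D))
countWords-lastDescent zero L q = countWords-cong L (λ x _ → cong q (sym (++-identityʳ x)))
countWords-lastDescent (suc s) L q = begin
  countWords (suc (s + L)) P
    ≡⟨ countWords-∷ʳ (s + L) P ⟩
  countWords (s + L) (λ w → P (w ∷ʳ U)) + countWords (s + L) (λ w → P (w ∷ʳ D))
    ≡⟨ cong₂ _+_ (trans (countWords-cong (s + L) (λ w _ → ends-in-U w)) (countWords-false (s + L)))
                 (countWords-cong (s + L) (λ w _ → ends-in-D w)) ⟩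
  countWords (s + L) (λ w → (s ≤ᵇ lastDescent w) ∧ q (w ∷ʳ D))
    ≡⟨ countWords-lastDescent s L (λ w → q (w ∷ʳ D)) ⟩
  countWords L (λ x → q ((x ++ replicate s D) ∷ʳ D))
    ≡⟨ countWords-cong L (λ x _ → cong q (trans (++-assoc x (replicate s D) (D ∷ [])) (cong (x ++_) (replicate-∷ʳ s D)))) ⟩
  countWords L (λ x → q (x ++ replicate (suc s) D)) ∎
  where
  open ≡-Reasoning
  P : List Step → Bool
  P w = (suc s ≤ᵇ lastDescent w) ∧ q w
  ends-in-U : ∀ w → P (w ∷ʳ U) ≡ false
  ends-in-U w = cong (λ d → (suc s ≤ᵇ d) ∧ q (w ∷ʳ U)) (lastDescent-∷ʳ w U)
  ends-in-D : ∀ w → P (w ∷ʳ D) ≡ (s ≤ᵇ lastDescent w) ∧ q (w ∷ʳ D)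
  ends-in-D w = trans (cong (λ d → (suc s ≤ᵇ d) ∧ q (w ∷ʳ D)) (lastDescent-∷ʳ w D))
                 (cong (_∧ q (w ∷ʳ D)) ([1+m]≤ᵇ[1+n]≡m≤ᵇn s (lastDescent w)))

dyckFrom-replicateU-++ : ∀ r h w → dyckFrom h (replicate r U ++ w) ≡ dyckFrom (r + h) w
dyckFrom-replicateU-++ zero h w = refl
dyckFrom-replicateU-++ (suc r) h w = trans (dyckFrom-replicateU-++ r (suc h) w) (cong (λ k → dyckFrom k w) (+-suc r h))

-- Whether the walk w from height h is on the axis before its last step.
touchesAxis : ℕ → List Step → Bool
touchesAxis h [] = false
touchesAxis zero (_ ∷ _) = true
touchesAxis (suc h) (U ∷ w) = touchesAxis (2 + h) w
touchesAxis (suc h) (D ∷ w) = touchesAxis h w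

onAxisAfterFrom : ℕ → List Step → ℕ → Bool
onAxisAfterFrom h w i = (h + countᵇ isU (take i w)) ≡ᵇ countᵇ isD (take i w)

any-applyUpTo-cong : ∀ k {p q : ℕ → Bool} {f g : ℕ → ℕ} →
  (∀ i → p (f i) ≡ q (g i)) → any p (applyUpTo f k) ≡ any q (applyUpTo g k)
any-applyUpTo-cong zero pf≗qg = refl
any-applyUpTo-cong (suc k) pf≗qg = cong₂ _∨_ (pf≗qg 0) (any-applyUpTo-cong k (pf≗qg ∘ suc))

any-onAxisAfterFrom : ∀ h w → any (onAxisAfterFrom h w) (upTo (length w)) ≡ touchesAxis h w
any-onAxisAfterFrom h [] = refl
any-onAxisAfterFrom zero (_ ∷ _) = refl
any-onAxisAfterFrom (suc h) (U ∷ w) =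
  trans (any-applyUpTo-cong (length w) (λ i → cong (_≡ᵇ countᵇ isD (take i w)) (cong suc (+-suc h _))))
        (any-onAxisAfterFrom (2 + h) w)
any-onAxisAfterFrom (suc h) (D ∷ w) =
  trans (any-applyUpTo-cong (length w) (λ _ → refl)) (any-onAxisAfterFrom h w)

hasInteriorReturn-replicateU-++ : ∀ r w → hasInteriorReturn (replicate (suc r) U ++ w) ≡ touchesAxis (suc r) w
hasInteriorReturn-replicateU-++ r w = begin
  hasInteriorReturn (U ∷ v)                        ≡⟨ any-applyUpTo-cong (length v) (λ _ → refl) ⟩
  any (onAxisAfterFrom 1 v) (upTo (length v))      ≡⟨ any-onAxisAfterFrom 1 v ⟩
  touchesAxis 1 v                                  ≡⟨ touchesAxis-replicateU-++ r ⟩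
  touchesAxis (r + 1) w                            ≡⟨ cong (λ k → touchesAxis k w) (+-comm r 1) ⟩
  touchesAxis (suc r) w                            ∎
  where
  open ≡-Reasoning
  v = replicate r U ++ w
  touchesAxis-replicateU-++ : ∀ r {h} → touchesAxis (suc h) (replicate r U ++ w) ≡ touchesAxis (r + suc h) w
  touchesAxis-replicateU-++ zero = refl
  touchesAxis-replicateU-++ (suc r) {h} = trans (touchesAxis-replicateU-++ r) (cong (λ k → touchesAxis k w) (+-suc r (suc h)))

-- With h = r and t = s these count the middle parts x of the Dyck paths U^r x D^s.
descentWalks : ℕ → ℕ → ℕ → ℕ
descentWalks h t M = countWords M (λ x → dyckFrom h (x ++ replicate t D))

descentWalksTouching : ℕ → ℕ → ℕ → ℕ
descentWalksTouching h t M =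
  countWords M (λ x → dyckFrom h (x ++ replicate t D) ∧ touchesAxis h (x ++ replicate t D))

descentWalks-zero : ∀ h M → descentWalks h 0 M ≡ dyckWalks h M
descentWalks-zero h M = countWords-cong M (λ x _ → cong (dyckFrom h) (++-identityʳ x))

descentWalksTouching-axis : ∀ t M → descentWalksTouching 0 (suc t) M ≡ descentWalks 0 (suc t) M
descentWalksTouching-axis t M = countWords-cong M (λ x _ →
  trans (cong (dyckFrom 0 (x ++ replicate (suc t) D) ∧_) (touchesAxis-axis x)) (∧-identityʳ _))
  where
  touchesAxis-axis : ∀ x → touchesAxis 0 (x ++ replicate (suc t) D) ≡ true
  touchesAxis-axis [] = refl
  touchesAxis-axis (_ ∷ _) = refl

dyckFrom∧touchesAxis-replicateD : ∀ h t → dyckFrom h (replicate t D) ∧ touchesAxis h (replicate t D) ≡ false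
dyckFrom∧touchesAxis-replicateD zero zero = refl
dyckFrom∧touchesAxis-replicateD zero (suc t) = refl
dyckFrom∧touchesAxis-replicateD (suc h) zero = refl
dyckFrom∧touchesAxis-replicateD (suc h) (suc t) = dyckFrom∧touchesAxis-replicateD h t

-- A walk from height h + 1 that reaches the axis only at its end is, shifted down
-- by one, a walk from height h.
descentWalks-suc-suc : ∀ M h t →
  descentWalks (suc h) (suc t) M ≡ descentWalksTouching (suc h) (suc t) M + descentWalks h t M
descentWalks-suc-suc zero h t rewrite dyckFrom∧touchesAxis-replicateD h t = refl
descentWalks-suc-suc (suc M) zero t = begin
  R 2 (suc t) M + R 0 (suc t) M
    ≡⟨ cong₂ _+_ (descentWalks-suc-suc M 1 t) (sym (descentWalksTouching-axis t M)) ⟩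
  (Z 2 (suc t) M + R 1 t M) + Z 0 (suc t) M
    ≡⟨ regroup (Z 2 (suc t) M) (R 1 t M) (Z 0 (suc t) M) ⟩
  (Z 2 (suc t) M + Z 0 (suc t) M) + (R 1 t M + 0)
    ≡⟨ cong (λ n → Z 1 (suc t) (suc M) + (R 1 t M + n)) (countWords-false M) ⟨
  Z 1 (suc t) (suc M) + R 0 t (suc M) ∎
  where
  open ≡-Reasoning
  R = descentWalks
  Z = descentWalksTouching
  regroup : ∀ a b c → (a + b) + c ≡ (a + c) + (b + 0)
  regroup = solve-∀
descentWalks-suc-suc (suc M) (suc h) t = begin
  R (3 + h) (suc t) M + R (suc h) (suc t) M
    ≡⟨ cong₂ _+_ (descentWalks-suc-suc M (2 + h) t) (descentWalks-suc-suc M h t) ⟩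
  (Z (3 + h) (suc t) M + R (2 + h) t M) + (Z (suc h) (suc t) M + R h t M)
    ≡⟨ interchange (Z (3 + h) (suc t) M) (R (2 + h) t M) (Z (suc h) (suc t) M) (R h t M) ⟩
  Z (2 + h) (suc t) (suc M) + R (suc h) t (suc M) ∎
  where
  open ≡-Reasoning
  R = descentWalks
  Z = descentWalksTouching

descentWalksTouching≡dyckWalks : ∀ M h t → descentWalksTouching (suc h) (suc t) M ≡ dyckWalks (2 + h + t) M
descentWalks-axis : ∀ M t → descentWalks 0 t M ≡ dyckWalks t M

descentWalksTouching≡dyckWalks zero h t = cong (λ b → if b then 1 else 0) (dyckFrom∧touchesAxis-replicateD h t)
descentWalksTouching≡dyckWalks (suc M) zero t = cong₂ _+_ (descentWalksTouching≡dyckWalks M 1 t)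
  (trans (descentWalksTouching-axis t M) (descentWalks-axis M (suc t)))
descentWalksTouching≡dyckWalks (suc M) (suc h) t =
  cong₂ _+_ (descentWalksTouching≡dyckWalks M (2 + h) t) (descentWalksTouching≡dyckWalks M h t)

descentWalks-axis M zero = descentWalks-zero 0 M
descentWalks-axis zero (suc t) = refl
descentWalks-axis (suc M) (suc t) = begin
  descentWalks 1 (suc t) M + countWords M (λ _ → false)
    ≡⟨ cong₂ _+_ (descentWalks-suc-suc M 0 t) (countWords-false M) ⟩
  descentWalksTouching 1 (suc t) M + descentWalks 0 t M + 0
    ≡⟨ cong₂ (λ a b → a + b + 0) (descentWalksTouching≡dyckWalks M 0 t) (descentWalks-axis M t) ⟩
  dyckWalks (2 + t) M + dyckWalks t M + 0
    ≡⟨ +-identityʳ _ ⟩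
  dyckWalks (suc t) (suc M) ∎
  where open ≡-Reasoning

descentWalks≡ΣdyckWalks : ∀ M a b → descentWalks a b M ≡ Σ[ j < suc (a ⊓ b) ] dyckWalks (a + b ∸ 2 * j) M
descentWalks≡ΣdyckWalks M zero b = trans (descentWalks-axis M b) (sym (+-identityʳ _))
descentWalks≡ΣdyckWalks M (suc a) zero = begin
  descentWalks (suc a) 0 M     ≡⟨ descentWalks-zero (suc a) M ⟩
  dyckWalks (suc a) M          ≡⟨ cong (λ h → dyckWalks h M) (+-identityʳ (suc a)) ⟨
  dyckWalks (suc a + 0) M      ≡⟨ +-identityʳ _ ⟨
  dyckWalks (suc a + 0) M + 0  ∎
  where open ≡-Reasoning
descentWalks≡ΣdyckWalks M (suc a) (suc b) = begin
  descentWalks (suc a) (suc b) M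
    ≡⟨ descentWalks-suc-suc M a b ⟩
  descentWalksTouching (suc a) (suc b) M + descentWalks a b M
    ≡⟨ cong₂ _+_ (descentWalksTouching≡dyckWalks M a b) (descentWalks≡ΣdyckWalks M a b) ⟩
  dyckWalks (2 + a + b) M + Σ[ j < suc (a ⊓ b) ] dyckWalks (a + b ∸ 2 * j) M
    ≡⟨ cong₂ _+_ (cong (λ h → dyckWalks (suc h) M) (+-suc a b))
                 (Σ<-cong (suc (a ⊓ b)) (λ j _ → cong (λ h → dyckWalks h M) (shift j))) ⟨
  dyckWalks (suc a + suc b) M + Σ[ j < suc (a ⊓ b) ] dyckWalks (suc a + suc b ∸ 2 * suc j) M ∎
  where
  open ≡-Reasoning
  shift : ∀ j → suc a + suc b ∸ 2 * suc j ≡ a + b ∸ 2 * j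
  shift j = cong₂ _∸_ (cong suc (+-suc a b)) (*-suc 2 j)

countDyck≡countWords : ∀ n p → countDyck n p ≡ countWords (2 * n) (λ w → dyckFrom 0 w ∧ p w)
countDyck≡countWords n p = trans (length-filterᵇ-allWords (2 * n) _) (countWords-cong (2 * n) (λ w ∣w∣≡2n →
  cong (λ b → (b ∧ dyckFrom 0 w) ∧ p w) (trans (cong (_≡ᵇ 2 * n) ∣w∣≡2n) 2n≡ᵇ2n)))
  where
  2n≡ᵇ2n : (2 * n ≡ᵇ 2 * n) ≡ true
  2n≡ᵇ2n = Equivalence.to T-≡ (≡⇒≡ᵇ (2 * n) (2 * n) refl)

∧-reorder : ∀ d a q b → d ∧ (a ∧ (q ∧ b)) ≡ a ∧ (b ∧ (d ∧ q))
∧-reorder d false q b = ∧-zeroʳ d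
∧-reorder d true q false = trans (cong (d ∧_) (∧-zeroʳ q)) (∧-zeroʳ d)
∧-reorder d true q true = cong (d ∧_) (∧-identityʳ q)

≤ᵇ-∧-≤ᵇ-false : ∀ {r s a b} q → a + b < r + s → (r ≤ᵇ a) ∧ q ∧ (s ≤ᵇ b) ≡ false
≤ᵇ-∧-≤ᵇ-false {r} {s} {a} {b} q a+b<r+s with r ≤ᵇ a in r≤ᵇa | s ≤ᵇ b in s≤ᵇb
... | false | _ = refl
... | true | false = ∧-zeroʳ q
... | true | true = ⊥-elim (<⇒≱ a+b<r+s (+-mono-≤ (≤ᵇ⇒≤ r a (Equivalence.from T-≡ r≤ᵇa))
                                                  (≤ᵇ⇒≤ s b (Equivalence.from T-≡ s≤ᵇb))))

countDyck-peel : ∀ r s n (q : List Step → Bool) → r + s ≤ 2 * n →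
  countDyck n (λ w → (r ≤ᵇ firstAscent w) ∧ q w ∧ (s ≤ᵇ lastDescent w))
    ≡ countWords (2 * n ∸ (r + s)) (λ x → dyckFrom r (x ++ replicate s D) ∧ q (replicate r U ++ x ++ replicate s D))
countDyck-peel r s n q r+s≤2n = begin
  countDyck n P
    ≡⟨ countDyck≡countWords n P ⟩
  countWords (2 * n) (λ w → dyckFrom 0 w ∧ P w)
    ≡⟨ countWords-cong (2 * n) (λ w _ → ∧-reorder (dyckFrom 0 w) (r ≤ᵇ firstAscent w) (q w) (s ≤ᵇ lastDescent w)) ⟩
  countWords (2 * n) (λ w → (r ≤ᵇ firstAscent w) ∧ Q w)
    ≡⟨ cong (λ k → countWords k (λ w → (r ≤ᵇ firstAscent w) ∧ Q w)) 2n≡r+s+M ⟩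
  countWords (r + (s + M)) (λ w → (r ≤ᵇ firstAscent w) ∧ Q w)
    ≡⟨ countWords-firstAscent r (s + M) Q ⟩
  countWords (s + M) (λ y → Q (replicate r U ++ y))
    ≡⟨ countWords-cong (s + M) (λ y _ → cong₂ (λ d b → (s ≤ᵇ d) ∧ (b ∧ q (replicate r U ++ y)))
                                              (lastDescent-replicateU-++ r y) (dyckFrom-replicateU-++-axis y)) ⟩
  countWords (s + M) (λ y → (s ≤ᵇ lastDescent y) ∧ (dyckFrom r y ∧ q (replicate r U ++ y)))
    ≡⟨ countWords-lastDescent s M (λ y → dyckFrom r y ∧ q (replicate r U ++ y)) ⟩
  countWords M (λ x → dyckFrom r (x ++ replicate s D) ∧ q (replicate r U ++ x ++ replicate s D)) ∎
  where
  open ≡-Reasoning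
  M = 2 * n ∸ (r + s)
  P : List Step → Bool
  P w = (r ≤ᵇ firstAscent w) ∧ q w ∧ (s ≤ᵇ lastDescent w)
  Q : List Step → Bool
  Q w = (s ≤ᵇ lastDescent w) ∧ (dyckFrom 0 w ∧ q w)
  2n≡r+s+M : 2 * n ≡ r + (s + M)
  2n≡r+s+M = trans (sym (m+[n∸m]≡n r+s≤2n)) (+-assoc r s M)
  dyckFrom-replicateU-++-axis : ∀ y → dyckFrom 0 (replicate r U ++ y) ≡ dyckFrom r y
  dyckFrom-replicateU-++-axis y = trans (dyckFrom-replicateU-++ r 0 y) (cong (λ h → dyckFrom h y) (+-identityʳ r))

countDyck-overlong : ∀ r s n (q : List Step → Bool) → 2 * n < r + s →
  countDyck n (λ w → (r ≤ᵇ firstAscent w) ∧ q w ∧ (s ≤ᵇ lastDescent w)) ≡ 0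
countDyck-overlong r s n q 2n<r+s = begin
  countDyck n (λ w → (r ≤ᵇ firstAscent w) ∧ q w ∧ (s ≤ᵇ lastDescent w))
    ≡⟨ countDyck≡countWords n _ ⟩
  countWords (2 * n) (λ w → dyckFrom 0 w ∧ ((r ≤ᵇ firstAscent w) ∧ q w ∧ (s ≤ᵇ lastDescent w)))
    ≡⟨ countWords-cong (2 * n) (λ w ∣w∣≡2n →
         trans (cong (dyckFrom 0 w ∧_) (≤ᵇ-∧-≤ᵇ-false {r} {s} (q w) (too-short w ∣w∣≡2n))) (∧-zeroʳ _)) ⟩
  countWords (2 * n) (λ _ → false)
    ≡⟨ countWords-false (2 * n) ⟩
  0 ∎
  where
  open ≡-Reasoning
  too-short : ∀ w → length w ≡ 2 * n → firstAscent w + lastDescent w < r + s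
  too-short w ∣w∣≡2n = ≤-<-trans (firstAscent+lastDescent≤length w) (subst (_< r + s) (sym ∣w∣≡2n) 2n<r+s)

-- Imported only here: the integer prefix +_ makes natural-number sections such
-- as (n +_) ambiguous.
open import Data.Integer using (ℤ; +_; -[1+_]; -_; _-_) renaming (_+_ to _+ℤ_)
import Data.Integer.Properties as ℤ
import Data.Integer.Tactic.RingSolver as ℤSolver

Cgen-suc≡dyckWalks : ∀ a L (z : ℤ) → + L ≡ + a +ℤ (z +ℤ z) → Cgen (suc a) z ≡ dyckWalks a L
Cgen-suc≡dyckWalks a L (+ m) L≡a+2m = begin
  CPow (suc a) m             ≡⟨ CPow≡CPowWalks (suc a) m ⟩
  dyckWalks a (a + 2 * m)    ≡⟨ cong (λ k → dyckWalks a (a + (m + k))) (+-identityʳ m) ⟩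
  dyckWalks a (a + (m + m))  ≡⟨ cong (dyckWalks a) (ℤ.+-injective L≡a+2m) ⟨
  dyckWalks a L              ∎
  where open ≡-Reasoning
Cgen-suc≡dyckWalks a L -[1+ m ] L≡a+2z = sym (L<h⇒dyckWalks≡0 (subst (L <_) L+2+2m≡a (m<m+n L z<s)))
  where
  L+2+2m≡a : L + (suc m + suc m) ≡ a
  L+2+2m≡a = ℤ.+-injective (trans (cong (_+ℤ (+ suc m +ℤ + suc m)) L≡a+2z) (+-double-cancel (+ a) -[1+ m ]))
    where
    +-double-cancel : ∀ (y z : ℤ) → y +ℤ (z +ℤ z) +ℤ (- z +ℤ - z) ≡ y
    +-double-cancel = ℤSolver.solve-∀

Cgen-negative : ∀ k (z : ℤ) {b c} → z +ℤ + c ≡ + b → b < c → Cgen k z ≡ 0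
Cgen-negative k (+ m) {b} {c} m+c≡b b<c = ⊥-elim (<⇒≱ b<c (subst (c ≤_) (ℤ.+-injective m+c≡b) (m≤n+m c m)))
Cgen-negative k -[1+ m ] _ _ = refl

2*j≤r+s : ∀ {r s j} → j ≤ r ⊓ s → 2 * j ≤ r + s
2*j≤r+s {r} {s} {j} j≤r⊓s = subst (_≤ r + s) (cong (λ k → j + k) (sym (+-identityʳ j)))
  (+-mono-≤ (≤-trans j≤r⊓s (m⊓n≤m r s)) (≤-trans j≤r⊓s (m⊓n≤n r s)))

z+r+s≡n+j : ∀ n r s j → (+ n - + r - + s +ℤ + j) +ℤ + (r + s) ≡ + (n + j)
z+r+s≡n+j n r s j = ring (+ n) (+ r) (+ s) (+ j)
  where
  ring : ∀ (n r s j : ℤ) → (n - r - s +ℤ j) +ℤ (r +ℤ s) ≡ n +ℤ j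
  ring = ℤSolver.solve-∀

M≡a+2z : ∀ (M a n r s j z : ℤ) →
  M +ℤ (r +ℤ s) ≡ n +ℤ n → a +ℤ (j +ℤ j) ≡ r +ℤ s → z +ℤ (r +ℤ s) ≡ n +ℤ j → M ≡ a +ℤ (z +ℤ z)
M≡a+2z M a n r s j z M+r+s≡2n a+2j≡r+s z+r+s≡n+j = begin
  M
    ≡⟨ ℤSolver.solve (M ∷ r ∷ s ∷ []) ⟩
  M +ℤ (r +ℤ s) - (r +ℤ s)
    ≡⟨ cong (_- (r +ℤ s)) M+r+s≡2n ⟩
  n +ℤ n - (r +ℤ s)
    ≡⟨ ℤSolver.solve (n ∷ r ∷ s ∷ j ∷ []) ⟩
  (n +ℤ j) +ℤ (n +ℤ j) - (r +ℤ s) - (j +ℤ j)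
    ≡⟨ cong (λ x → x +ℤ x - (r +ℤ s) - (j +ℤ j)) z+r+s≡n+j ⟨
  (z +ℤ (r +ℤ s)) +ℤ (z +ℤ (r +ℤ s)) - (r +ℤ s) - (j +ℤ j)
    ≡⟨ ℤSolver.solve (z ∷ r ∷ s ∷ j ∷ []) ⟩
  (r +ℤ s) - (j +ℤ j) +ℤ (z +ℤ z)
    ≡⟨ cong (λ x → x - (j +ℤ j) +ℤ (z +ℤ z)) a+2j≡r+s ⟨
  a +ℤ (j +ℤ j) - (j +ℤ j) +ℤ (z +ℤ z)
    ≡⟨ ℤSolver.solve (a ∷ j ∷ z ∷ []) ⟩
  a +ℤ (z +ℤ z) ∎
  where open ≡-Reasoning

Cgen≡dyckWalks : ∀ r s n j → j ≤ r ⊓ s → r + s ≤ 2 * n →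
  Cgen (r + s + 1 ∸ 2 * j) (+ n - + r - + s +ℤ + j) ≡ dyckWalks (r + s ∸ 2 * j) (2 * n ∸ (r + s))
Cgen≡dyckWalks r s n j j≤r⊓s r+s≤2n = begin
  Cgen (r + s + 1 ∸ 2 * j) z  ≡⟨ cong (λ k → Cgen k z) (trans (+-∸-comm 1 2j≤r+s) (+-comm a 1)) ⟩
  Cgen (suc a) z              ≡⟨ Cgen-suc≡dyckWalks a M z +M≡+a+2z ⟩
  dyckWalks a M               ∎
  where
  open ≡-Reasoning
  z = + n - + r - + s +ℤ + j
  a = r + s ∸ 2 * j
  M = 2 * n ∸ (r + s)
  2j≤r+s = 2*j≤r+s j≤r⊓s
  M+r+s≡2n : M + (r + s) ≡ n + n
  M+r+s≡2n = trans (m∸n+n≡m r+s≤2n) (cong (λ k → n + k) (+-identityʳ n))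
  a+2j≡r+s : a + (j + j) ≡ r + s
  a+2j≡r+s = trans (cong (λ k → a + (j + k)) (sym (+-identityʳ j))) (m∸n+n≡m 2j≤r+s)
  +M≡+a+2z : + M ≡ + a +ℤ (z +ℤ z)
  +M≡+a+2z = M≡a+2z (+ M) (+ a) (+ n) (+ r) (+ s) (+ j) z (cong +_ M+r+s≡2n) (cong +_ a+2j≡r+s) (z+r+s≡n+j n r s j)

Cgen-overlong : ∀ r s n j → j ≤ r ⊓ s → 2 * n < r + s → Cgen (r + s + 1 ∸ 2 * j) (+ n - + r - + s +ℤ + j) ≡ 0
Cgen-overlong r s n j j≤r⊓s 2n<r+s = Cgen-negative (r + s + 1 ∸ 2 * j) (+ n - + r - + s +ℤ + j)
  (z+r+s≡n+j n r s j) n+j<r+s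
  where
  double : ∀ n j → 2 * n + 2 * j ≡ (n + j) + (n + j)
  double = solve-∀
  n+j<r+s : n + j < r + s
  n+j<r+s = ≰⇒> (λ r+s≤n+j → <⇒≱ (subst (_< (r + s) + (r + s)) (double n j) (+-mono-<-≤ 2n<r+s (2*j≤r+s j≤r⊓s)))
                                  (+-mono-≤ r+s≤n+j r+s≤n+j))

countDyck-firstAscent-interiorReturn-lastDescent : ∀ r s n →
  countDyck n (λ w → (suc r ≤ᵇ firstAscent w) ∧ hasInteriorReturn w ∧ (suc s ≤ᵇ lastDescent w))
    ≡ Cgen (suc r + suc s + 1) (+ n - + suc r - + suc s)
countDyck-firstAscent-interiorReturn-lastDescent r s n with suc r + suc s ≤? 2 * n
... | yes r+s≤2n = begin
  countDyck n (λ w → (suc r ≤ᵇ firstAscent w) ∧ hasInteriorReturn w ∧ (suc s ≤ᵇ lastDescent w))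
    ≡⟨ countDyck-peel (suc r) (suc s) n hasInteriorReturn r+s≤2n ⟩
  countWords M (λ x → dyckFrom (suc r) (x ++ Ds) ∧ hasInteriorReturn (replicate (suc r) U ++ x ++ Ds))
    ≡⟨ countWords-cong M (λ x _ → cong (dyckFrom (suc r) (x ++ Ds) ∧_) (hasInteriorReturn-replicateU-++ r (x ++ Ds))) ⟩
  descentWalksTouching (suc r) (suc s) M
    ≡⟨ descentWalksTouching≡dyckWalks M r s ⟩
  dyckWalks (2 + r + s) M
    ≡⟨ cong (λ h → dyckWalks (suc h) M) (+-suc r s) ⟨
  dyckWalks (suc r + suc s) M
    ≡⟨ Cgen≡dyckWalks (suc r) (suc s) n 0 z≤n r+s≤2n ⟨
  Cgen (suc r + suc s + 1) (z +ℤ + 0)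
    ≡⟨ cong (Cgen (suc r + suc s + 1)) (ℤ.+-identityʳ z) ⟩
  Cgen (suc r + suc s + 1) z ∎
  where
  open ≡-Reasoning
  M = 2 * n ∸ (suc r + suc s)
  Ds = replicate (suc s) D
  z = + n - + suc r - + suc s
... | no r+s≰2n = begin
  countDyck n (λ w → (suc r ≤ᵇ firstAscent w) ∧ hasInteriorReturn w ∧ (suc s ≤ᵇ lastDescent w))
    ≡⟨ countDyck-overlong (suc r) (suc s) n hasInteriorReturn (≰⇒> r+s≰2n) ⟩
  0
    ≡⟨ Cgen-overlong (suc r) (suc s) n 0 z≤n (≰⇒> r+s≰2n) ⟨
  Cgen (suc r + suc s + 1) (z +ℤ + 0)
    ≡⟨ cong (Cgen (suc r + suc s + 1)) (ℤ.+-identityʳ z) ⟩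
  Cgen (suc r + suc s + 1) z ∎
  where
  open ≡-Reasoning
  z = + n - + suc r - + suc s

countDyck-firstAscent-lastDescent : ∀ r s n →
  countDyck n (λ w → (r ≤ᵇ firstAscent w) ∧ (s ≤ᵇ lastDescent w))
    ≡ sum (map (λ j → Cgen (r + s + 1 ∸ 2 * j) (+ n - + r - + s +ℤ + j)) (upTo (suc (r ⊓ s))))
countDyck-firstAscent-lastDescent r s n with r + s ≤? 2 * n
... | yes r+s≤2n = begin
  countDyck n (λ w → (r ≤ᵇ firstAscent w) ∧ (s ≤ᵇ lastDescent w))
    ≡⟨ countDyck-peel r s n (λ _ → true) r+s≤2n ⟩
  countWords M (λ x → dyckFrom r (x ++ replicate s D) ∧ true)
    ≡⟨ countWords-cong M (λ x _ → ∧-identityʳ _) ⟩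
  descentWalks r s M
    ≡⟨ descentWalks≡ΣdyckWalks M r s ⟩
  Σ[ j < suc (r ⊓ s) ] dyckWalks (r + s ∸ 2 * j) M
    ≡⟨ Σ<-cong (suc (r ⊓ s)) (λ j j<1+r⊓s → Cgen≡dyckWalks r s n j (≤-pred j<1+r⊓s) r+s≤2n) ⟨
  Σ[ j < suc (r ⊓ s) ] term j
    ≡⟨ sum-map-applyUpTo (suc (r ⊓ s)) id term ⟨
  sum (map term (upTo (suc (r ⊓ s)))) ∎
  where
  open ≡-Reasoning
  M = 2 * n ∸ (r + s)
  term = λ j → Cgen (r + s + 1 ∸ 2 * j) (+ n - + r - + s +ℤ + j)
... | no r+s≰2n = begin
  countDyck n (λ w → (r ≤ᵇ firstAscent w) ∧ (s ≤ᵇ lastDescent w))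
    ≡⟨ countDyck-overlong r s n (λ _ → true) (≰⇒> r+s≰2n) ⟩
  0
    ≡⟨ Σ<-zero (suc (r ⊓ s)) (λ j j<1+r⊓s → Cgen-overlong r s n j (≤-pred j<1+r⊓s) (≰⇒> r+s≰2n)) ⟨
  Σ[ j < suc (r ⊓ s) ] term j
    ≡⟨ sum-map-applyUpTo (suc (r ⊓ s)) id term ⟨
  sum (map term (upTo (suc (r ⊓ s)))) ∎
  where
  open ≡-Reasoning
  term = λ j → Cgen (r + s + 1 ∸ 2 * j) (+ n - + r - + s +ℤ + j)

lemma5 : (r s n : ℕ) → .{{NonZero r}} → .{{NonZero s}} → .{{NonZero n}} →
    (countDyck n (λ w → (r ≤ᵇ firstAscent w) ∧ hasInteriorReturn w ∧ (s ≤ᵇ lastDescent w))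
      ≡ Cgen (r + s + 1) (+ n - + r - + s))
    × (countDyck n (λ w → (r ≤ᵇ firstAscent w) ∧ (s ≤ᵇ lastDescent w))
      ≡ sum (map (λ j → Cgen (r + s + 1 ∸ 2 * j) (+ n - + r - + s +ℤ + j)) (upTo (suc (r ⊓ s)))))
lemma5 (suc r) (suc s) n =
  countDyck-firstAscent-interiorReturn-lastDescent r s n , countDyck-firstAscent-lastDescent (suc r) (suc s) n
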